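{- Let $n\ge 3$ be an integer and let $S=\{i_1,i_2,\dots,i_k\}\subseteq[n]$ with $i_1<i_2<\dots<i_k$. Then $CP_n(S)\neq\emptyset$ if and only if $i_j\ge 2j+1$ for all $j\in[k]$.
   Context: $[n]=\{1,\dots,n\}$ and $\mathfrak S_n$ is the set of permutations of $[n]$, written in one-line notation $\sigma=\sigma(1)\sigma(2)\cdots\sigma(n)$. The circular peak set of $\sigma$ is $CP(\sigma)=\{\sigma(i)\mid 2\le i\le n-1,\ \sigma(i-1)<\sigma(i)>\sigma(i+1)\}$. For $S\subseteq[n]$, $CP_n(S)=\{\sigma\in\mathfrak S_n\mid CP(\sigma)=S\}$. -}

module Defs where

open import Data.Nat using (ℕ; suc; _<_)
open import Data.Fin using (Fin; toℕ)
open import Data.Fin.Permutation using (Permutation′; _⟨$⟩ʳ_)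
open import Data.Product using (Σ-syntax; ∃-syntax; _×_)
open import Relation.Binary.PropositionalEquality using (_≡_)

-- Permutations of [n] are bijections Fin n → Fin n; position/value i : Fin n
-- stands for the element toℕ i + 1 of [n] = {1,…,n}.

-- Here i, j, k are consecutive
-- 0-based positions (so j is automatically an interior position).
IsCircularPeak : {n : ℕ} → Permutation′ n → ℕ → Set
IsCircularPeak {n} σ v =
  ∃[ i ] ∃[ j ] ∃[ k ]
    ( toℕ j ≡ suc (toℕ i)
    × toℕ k ≡ suc (toℕ j)
    × toℕ (σ ⟨$⟩ʳ i) < toℕ (σ ⟨$⟩ʳ j)
    × toℕ (σ ⟨$⟩ʳ k) < toℕ (σ ⟨$⟩ʳ j)
    × v ≡ suc (toℕ (σ ⟨$⟩ʳ j)) )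

-- Necessity: the peaks i₁ < ⋯ < i_j and their neighbours, all smaller than the peak they flank,
-- lie in [i_j]; as two peaks are never adjacent, this gives 2j + 1 distinct letters of [i_j].
-- Sufficiency: insert 1, …, n one by one into a word a₁ p₁ a₂ p₂ ⋯ a_k p_k followed by an
-- increasing run, a non-peak at the end of the run and a peak between the first two letters
-- of the run. When i_j is inserted, the run has i_j − 1 − 2(j − 1) ≥ 2 letters.
module Submission where

open import Defs
open import Data.Nat using (ℕ; zero; suc; _+_; _*_; _≤_; _<_; z≤n; s≤s; s≤s⁻¹)
open import Data.Nat.Properties
open import Data.Fin using (Fin; toℕ; zero; suc)
open import Data.Fin.Properties using (toℕ-injective; toℕ-cast; injective⇒≤)
open import Data.Fin.Permutation using (Permutation′; _⟨$⟩ʳ_; _∘ₚ_; cast-id)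
open import Data.List using (List; []; _∷_; [_]; _++_; _∷ʳ_; length; lookup; map; filter; tabulate; upTo)
open import Data.List.Properties using (length-map; length-upTo; lookup-upTo; tabulate-cong; tabulate-lookup; filter-accept; filter-reject; length-++; map-++; ∷ʳ-++; ++-identityʳ; upTo-∷ʳ)
open import Data.List.Membership.Propositional using (_∈_)
open import Data.List.Membership.Propositional.Properties using (∈-lookup; ∈-upTo⁺; ∈-filter⁻; ∈-map⁺; ∈-map⁻; ∈-++⁺ʳ)
open import Data.List.Relation.Binary.Subset.Propositional using (_⊆_)
open import Data.List.Relation.Unary.Any using (here; there; index)
open import Data.List.Relation.Unary.Any.Properties using (lookup-index)
open import Data.List.Relation.Unary.All using (All; []; _∷_)
import Data.List.Relation.Unary.All as All
open import Data.List.Relation.Unary.All.Properties using (all-upTo)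
open import Data.List.Relation.Unary.AllPairs using (AllPairs; _∷_)
import Data.List.Relation.Unary.AllPairs as AllPairs
open import Data.List.Relation.Unary.Linked using (Linked; []; [-]; _∷_)
import Data.List.Relation.Unary.Linked as Linked
open import Data.List.Relation.Unary.Linked.Properties using (Linked⇒AllPairs)
open import Data.List.Relation.Unary.Unique.Propositional using (Unique)
import Data.List.Relation.Unary.Unique.Propositional.Properties as Unique
open import Data.List.Relation.Binary.Permutation.Propositional using (_↭_; prep; ↭-refl; ↭-sym; ↭-trans; ↭-reflexive; ↭⇒↭ₛ)
open import Data.List.Relation.Binary.Permutation.Propositional.Properties using (All-resp-↭; ↭-length; ++⁺ʳ; ∷↭∷ʳ)
open import Data.List.Relation.Binary.Permutation.Setoid using (onIndices)
open import Data.List.Relation.Binary.Permutation.Setoid.Properties using (onIndices-lookup)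
open import Data.Product using (∃-syntax; _×_; _,_; proj₁; proj₂)
open import Function using (_∘_; id)
open import Function.Bundles using (_⇔_; mk⇔; Equivalence; Injection)
open import Function.Properties.Equivalence using () renaming (trans to ⇔-trans)
open import Function.Properties.Inverse using (↔⇒↣)
open import Relation.Nullary using (Dec; yes; no; ¬_; contradiction)
open import Relation.Nullary.Decidable using (_×-dec_)
open import Relation.Binary.PropositionalEquality using (_≡_; refl; sym; trans; cong; subst; subst₂; ≢-sym; setoid; module ≡-Reasoning)

data Peak : List ℕ → ℕ → Set where
  here  : ∀ {a b c r} → a < b → c < b → Peak (a ∷ b ∷ c ∷ r) b
  there : ∀ {x w b} → Peak w b → Peak (x ∷ w) b

Peak-tabulate⁺ : ∀ {n} (f : Fin n → ℕ) {i j k : Fin n} →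
                 toℕ j ≡ suc (toℕ i) → toℕ k ≡ suc (toℕ j) → f i < f j → f k < f j →
                 Peak (tabulate f) (f j)
Peak-tabulate⁺ f {zero} {suc zero} {suc (suc zero)} _ _ fi<fj fk<fj = here fi<fj fk<fj
Peak-tabulate⁺ f {suc i} {suc j} {suc k} j≡1+i k≡1+j fi<fj fk<fj =
  there (Peak-tabulate⁺ (f ∘ suc) (suc-injective j≡1+i) (suc-injective k≡1+j) fi<fj fk<fj)
Peak-tabulate⁺ f {zero} {zero} ()
Peak-tabulate⁺ f {zero} {suc (suc _)} ()
Peak-tabulate⁺ f {zero} {suc zero} {zero} _ ()
Peak-tabulate⁺ f {zero} {suc zero} {suc zero} _ ()
Peak-tabulate⁺ f {zero} {suc zero} {suc (suc (suc _))} _ ()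
Peak-tabulate⁺ f {suc _} {zero} ()
Peak-tabulate⁺ f {suc _} {suc _} {zero} _ ()

Peak-tabulate⁻ : ∀ {n} (f : Fin n → ℕ) {b} → Peak (tabulate f) b →
                 ∃[ i ] ∃[ j ] ∃[ k ] (toℕ j ≡ suc (toℕ i) × toℕ k ≡ suc (toℕ j) ×
                                       f i < f j × f k < f j × b ≡ f j)
Peak-tabulate⁻ {suc (suc (suc _))} f (here fi<fj fk<fj) =
  zero , suc zero , suc (suc zero) , refl , refl , fi<fj , fk<fj , refl
Peak-tabulate⁻ {suc _} f (there p) with Peak-tabulate⁻ (f ∘ suc) p
... | i , j , k , j≡1+i , k≡1+j , fi<fj , fk<fj , b≡fj =
  suc i , suc j , suc k , cong suc j≡1+i , cong suc k≡1+j , fi<fj , fk<fj , b≡fj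

word : ∀ {n} → Permutation′ n → List ℕ
word σ = tabulate (λ i → toℕ (σ ⟨$⟩ʳ i))

-- Values in a word are 0-based, elements of [n] are 1-based.
PeakValue : List ℕ → ℕ → Set
PeakValue w v = ∃[ b ] (Peak w b × v ≡ suc b)

circularPeak⇔peakValue : ∀ {n} (σ : Permutation′ n) v → IsCircularPeak σ v ⇔ PeakValue (word σ) v
circularPeak⇔peakValue σ v = mk⇔
  (λ (i , j , k , j≡1+i , k≡1+j , σi<σj , σk<σj , v≡) →
     _ , Peak-tabulate⁺ _ j≡1+i k≡1+j σi<σj σk<σj , v≡)
  (λ (b , b-peak , v≡1+b) →
     let (i , j , k , j≡1+i , k≡1+j , σi<σj , σk<σj , b≡σj) = Peak-tabulate⁻ _ b-peak
     in  i , j , k , j≡1+i , k≡1+j , σi<σj , σk<σj , trans v≡1+b (cong suc b≡σj))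

word-unique : ∀ {n} (σ : Permutation′ n) → Unique (word σ)
word-unique σ = Unique.tabulate⁺ (Injection.injective (↔⇒↣ σ) ∘ toℕ-injective)

peakBelow? : ∀ t a b c → Dec (a < b × c < b × b < t)
peakBelow? t a b c = a <? b ×-dec c <? b ×-dec b <? t

consIf : ∀ {P : Set} → Dec P → ℕ → List ℕ → List ℕ
consIf (yes _) x xs = x ∷ xs
consIf (no _)  _ xs = xs

peaksBelow : ℕ → List ℕ → List ℕ
peaksBelow t (a ∷ w@(b ∷ c ∷ _)) = consIf (peakBelow? t a b c) b (peaksBelow t w)
peaksBelow t _ = []

peaksBelow-∷ : ∀ {t} x w → peaksBelow t w ⊆ peaksBelow t (x ∷ w)
peaksBelow-∷ {t} x (b ∷ c ∷ r) with peakBelow? t x b c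
... | yes _ = there
... | no _  = id

peaksBelow-complete : ∀ {t w b} → Peak w b → b < t → b ∈ peaksBelow t w
peaksBelow-complete {t} (here {a} {b} {c} a<b c<b) b<t with peakBelow? t a b c
... | yes _    = here refl
... | no ¬peak = contradiction (a<b , c<b , b<t) ¬peak
peaksBelow-complete (there {x} {w} b-peak) b<t = peaksBelow-∷ x w (peaksBelow-complete b-peak b<t)

peaksBelow-descent : ∀ {t b c} r → c < b → peaksBelow t (b ∷ c ∷ r) ≡ peaksBelow t (c ∷ r)
peaksBelow-descent [] _ = refl
peaksBelow-descent {t} {b} {c} (d ∷ r) c<b with peakBelow? t b c d
... | yes (b<c , _) = contradiction c<b (<-asym b<c)
... | no _          = refl

countBelow : ℕ → List ℕ → ℕ
countBelow t w = length (filter (_<? t) w)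

countBelow-accept : ∀ {t x} w → x < t → countBelow t (x ∷ w) ≡ suc (countBelow t w)
countBelow-accept {t} w x<t = cong length (filter-accept (_<? t) {xs = w} x<t)

countBelow-∷ : ∀ {t} x w → countBelow t w ≤ countBelow t (x ∷ w)
countBelow-∷ {t} x w with x <? t
... | yes x<t = ≤-trans (n≤1+n _) (≤-reflexive (sym (countBelow-accept {t} w x<t)))
... | no x≮t  = ≤-reflexive (cong length (sym (filter-reject (_<? t) {xs = w} x≮t)))

bound-unless-zero : ∀ {p s} → (0 < p → 2 * p + 1 ≤ s) → 1 ≤ s → 2 * p + 1 ≤ s
bound-unless-zero {zero}  _     1≤s = 1≤s
bound-unless-zero {suc _} bound _   = bound (s≤s z≤n)

peaksBelow-sparse : ∀ t w → 0 < length (peaksBelow t w) →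
                    2 * length (peaksBelow t w) + 1 ≤ countBelow t w
peaksBelow-sparse t (a ∷ b ∷ c ∷ r) nonempty
  with peakBelow? t a b c | peaksBelow-sparse t (b ∷ c ∷ r) | peaksBelow-sparse t (c ∷ r)
... | no _ | ih | _ = ≤-trans (ih nonempty) (countBelow-∷ {t} a (b ∷ c ∷ r))
... | yes (a<b , c<b , b<t) | _ | ih = begin
  2 * suc (length (peaksBelow t (b ∷ c ∷ r))) + 1
    ≡⟨ cong (λ ps → 2 * suc (length ps) + 1) (peaksBelow-descent r c<b) ⟩
  2 * suc p + 1
    ≡⟨ cong (_+ 1) (*-suc 2 p) ⟩
  2 + (2 * p + 1)
    ≤⟨ +-monoʳ-≤ 2 (bound-unless-zero ih (subst (1 ≤_) (sym (countBelow-accept {t} r c<t)) (s≤s z≤n))) ⟩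
  2 + countBelow t (c ∷ r)
    ≡⟨ sym (trans (countBelow-accept {t} (b ∷ c ∷ r) (<-trans a<b b<t))
                  (cong suc (countBelow-accept {t} (c ∷ r) b<t))) ⟩
  countBelow t (a ∷ b ∷ c ∷ r) ∎
  where
  open ≤-Reasoning
  p = length (peaksBelow t (c ∷ r))
  c<t = <-trans c<b b<t

lookup-injective : ∀ {A : Set} {xs : List A} → Unique xs → ∀ {i j} → lookup xs i ≡ lookup xs j → i ≡ j
lookup-injective (_ ∷ _) {zero} {zero} _ = refl
lookup-injective (x∉xs ∷ _) {zero} {suc j} x≡ = contradiction x≡ (All.lookup x∉xs (∈-lookup j))
lookup-injective (x∉xs ∷ _) {suc i} {zero} ≡x = contradiction (sym ≡x) (All.lookup x∉xs (∈-lookup i))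
lookup-injective (_ ∷ u) {suc i} {suc j} eq = cong suc (lookup-injective u eq)

Unique-⊆⇒length≤ : ∀ {A : Set} {xs ys : List A} → Unique xs → xs ⊆ ys → length xs ≤ length ys
Unique-⊆⇒length≤ {xs = xs} {ys} unique xs⊆ys = injective⇒≤ position-injective
  where
  position : Fin (length xs) → Fin (length ys)
  position i = index (xs⊆ys (∈-lookup i))
  position-injective : ∀ {i j} → position i ≡ position j → i ≡ j
  position-injective {i} {j} eq = lookup-injective unique (begin
    lookup xs i              ≡⟨ lookup-index (xs⊆ys (∈-lookup i)) ⟩
    lookup ys (position i)   ≡⟨ cong (lookup ys) eq ⟩
    lookup ys (position j)   ≡⟨ sym (lookup-index (xs⊆ys (∈-lookup j))) ⟩
    lookup xs j              ∎)
    where open ≡-Reasoning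

count-≤-lookup : ∀ {xs : List ℕ} → AllPairs _<_ xs → (j : Fin (length xs)) →
                 suc (toℕ j) ≤ length (filter (_≤? lookup xs j) xs)
count-≤-lookup {x ∷ xs} _ zero =
  subst (1 ≤_) (cong length (sym (filter-accept (_≤? x) {xs = xs} ≤-refl))) (s≤s z≤n)
count-≤-lookup {x ∷ xs} (x<xs ∷ sorted) (suc j) = begin
  suc (suc (toℕ j))                                ≤⟨ s≤s (count-≤-lookup sorted j) ⟩
  suc (length (filter (_≤? lookup xs j) xs))       ≡⟨ cong length (sym (filter-accept (_≤? lookup xs j) {xs = xs} x≤)) ⟩
  length (filter (_≤? lookup xs j) (x ∷ xs))       ∎
  where
  open ≤-Reasoning
  x≤ = <⇒≤ (All.lookup x<xs (∈-lookup j))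

Spaced : List ℕ → Set
Spaced is = (j : Fin (length is)) → 2 * suc (toℕ j) + 1 ≤ lookup is j

peaks-spaced : ∀ {w is} → Unique w → Linked _<_ is → (∀ {v} → v ∈ is → PeakValue w v) → Spaced is
peaks-spaced {w} {is} w-unique is-sorted is-peaks j = begin
  2 * suc (toℕ j) + 1               ≤⟨ +-monoˡ-≤ 1 (*-monoʳ-≤ 2 enough-peaks) ⟩
  2 * length (peaksBelow t w) + 1   ≤⟨ peaksBelow-sparse t w (≤-trans (s≤s z≤n) enough-peaks) ⟩
  countBelow t w                    ≤⟨ few-letters ⟩
  t                                 ∎
  where
  open ≤-Reasoning
  t = lookup is j
  sorted = Linked⇒AllPairs <-trans is-sorted
  early = filter (_≤? t) is
  early-unique : Unique early
  early-unique = Unique.filter⁺ (_≤? t) (AllPairs.map <⇒≢ sorted)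
  early-peaks : early ⊆ map suc (peaksBelow t w)
  early-peaks v∈early with ∈-filter⁻ (_≤? t) v∈early
  ... | v∈is , v≤t with is-peaks v∈is
  ... | b , b-peak , refl = ∈-map⁺ suc (peaksBelow-complete b-peak v≤t)
  enough-peaks : suc (toℕ j) ≤ length (peaksBelow t w)
  enough-peaks = begin
    suc (toℕ j)                          ≤⟨ count-≤-lookup sorted j ⟩
    length early                         ≤⟨ Unique-⊆⇒length≤ early-unique early-peaks ⟩
    length (map suc (peaksBelow t w))    ≡⟨ length-map suc (peaksBelow t w) ⟩
    length (peaksBelow t w)              ∎
  few-letters : countBelow t w ≤ t
  few-letters = begin
    countBelow t w   ≤⟨ Unique-⊆⇒length≤ (Unique.filter⁺ (_<? t) w-unique)
                                         (∈-upTo⁺ ∘ proj₂ ∘ ∈-filter⁻ (_<? t) {xs = w}) ⟩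
    length (upTo t)  ≡⟨ length-upTo t ⟩
    t                ∎

-- Zigzag w ps t: w = a₁ p₁ a₂ p₂ ⋯ aₖ pₖ q₁ ⋯ q_t with aᵢ < pᵢ > aᵢ₊₁ (where aₖ₊₁ = q₁)
-- and q₁ < ⋯ < q_t, so that ps = p₁ ⋯ pₖ.
data Zigzag : List ℕ → List ℕ → ℕ → Set where
  run  : ∀ {q t} → Linked _<_ q → length q ≡ t → Zigzag q [] t
  peak : ∀ {a p r w ps t} → a < p → r < p → Zigzag (r ∷ w) ps t → Zigzag (a ∷ p ∷ r ∷ w) (p ∷ ps) t

Zigzag-length : ∀ {w ps t} → Zigzag w ps t → length w ≡ 2 * length ps + t
Zigzag-length (run _ refl) = refl
Zigzag-length {ps = _ ∷ ps} {t} (peak _ _ z) =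
  trans (cong (2 +_) (Zigzag-length z)) (cong (_+ t) (sym (*-suc 2 (length ps))))

Linked⇒¬Peak : ∀ {q b} → Linked _<_ q → ¬ Peak q b
Linked⇒¬Peak (_ ∷ b<c ∷ _) (here _ c<b) = <-asym b<c c<b
Linked⇒¬Peak (_ ∷ sorted) (there b-peak) = Linked⇒¬Peak sorted b-peak

Zigzag-peak⇔ : ∀ {w ps t} → Zigzag w ps t → ∀ {b} → Peak w b ⇔ b ∈ ps
Zigzag-peak⇔ z = mk⇔ (to z) (from z)
  where
  to : ∀ {w ps t b} → Zigzag w ps t → Peak w b → b ∈ ps
  to (run sorted _) b-peak = contradiction b-peak (Linked⇒¬Peak sorted)
  to (peak _ _ _) (here _ _) = here refl
  to (peak _ r<p _) (there (here p<r _)) = contradiction r<p (<-asym p<r)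
  to (peak _ _ z) (there (there b-peak)) = there (to z b-peak)
  from : ∀ {w ps t b} → Zigzag w ps t → b ∈ ps → Peak w b
  from (peak a<p r<p _) (here refl) = here a<p r<p
  from (peak _ _ z) (there b∈ps) = there (there (from z b∈ps))

Linked-∷ʳ : ∀ {q v} → Linked _<_ q → All (_< v) q → Linked _<_ (q ∷ʳ v)
Linked-∷ʳ [] [] = [-]
Linked-∷ʳ [-] (x<v ∷ []) = x<v ∷ [-]
Linked-∷ʳ (x<y ∷ sorted) (_ ∷ below) = x<y ∷ Linked-∷ʳ sorted below

Zigzag-∷ʳ : ∀ {w ps t v} → All (_< v) w → Zigzag w ps t → Zigzag (w ∷ʳ v) ps (suc t)
Zigzag-∷ʳ {w} below (run sorted refl) =
  run (Linked-∷ʳ sorted below) (trans (length-++ w) (+-comm (length w) 1))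
Zigzag-∷ʳ (_ ∷ _ ∷ below) (peak a<p r<p z) = peak a<p r<p (Zigzag-∷ʳ below z)

Zigzag-insert : ∀ {x w ps t v} → All (_< v) (x ∷ w) → Zigzag (x ∷ w) ps (2 + t) →
                ∃[ w′ ] (Zigzag (x ∷ w′) (ps ∷ʳ v) (suc t) × x ∷ w′ ↭ (x ∷ w) ∷ʳ v)
Zigzag-insert {x} {q ∷ w} {v = v} (x<v ∷ q<v ∷ _) (run (_ ∷ sorted) length≡) =
  v ∷ q ∷ w , peak x<v q<v (run sorted (suc-injective length≡)) , prep x (∷↭∷ʳ v (q ∷ w))
Zigzag-insert (_ ∷ _ ∷ below) (peak {a} {p} {r} a<p r<p z) with Zigzag-insert below z
... | w′ , z′ , w′↭ = p ∷ r ∷ w′ , peak a<p r<p z′ , prep a (prep p w′↭)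

lookup-middle : ∀ {A : Set} xs {y : A} {ys} → ∃[ j ] (toℕ j ≡ length xs × lookup (xs ++ y ∷ ys) j ≡ y)
lookup-middle [] = zero , refl , refl
lookup-middle (_ ∷ xs) with lookup-middle xs
... | j , j≡ , y≡ = suc j , cong suc j≡ , y≡

Spaced-middle : ∀ xs {y ys} → Spaced (xs ++ y ∷ ys) → 2 * suc (length xs) + 1 ≤ y
Spaced-middle xs spaced with lookup-middle xs
... | j , j≡ , y≡ = subst₂ (λ m z → 2 * suc m + 1 ≤ z) j≡ y≡ (spaced j)

↭upTo⇒below : ∀ {w v} → w ↭ upTo v → All (_< v) w
↭upTo⇒below {v = v} w↭ = All-resp-↭ (↭-sym w↭) (all-upTo v)

↭upTo-∷ʳ : ∀ {w v} → w ↭ upTo v → w ∷ʳ v ↭ upTo (suc v)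
↭upTo-∷ʳ {v = v} w↭ = ↭-trans (++⁺ʳ [ v ] w↭) (↭-reflexive (upTo-∷ʳ v))

-- The construction after placing the letters 0, …, v - 1: w is the word so far, ps its peaks,
-- and rest the elements of is (1-based) still to be realised, all above v.
record Stage (is : List ℕ) (v : ℕ) : Set where
  constructor stage
  field
    {w ps rest} : List ℕ
    {t}         : ℕ
    zigzag      : Zigzag w ps t
    w↭upTo      : w ↭ upTo v
    split       : map suc ps ++ rest ≡ is
    pending     : Linked _<_ (v ∷ rest)

stage-zero : ∀ {is} → Linked _<_ is → All (1 ≤_) is → Stage is 0
stage-zero {[]} _ _ = stage (run [] refl) ↭-refl refl [-]
stage-zero {_ ∷ _} sorted (1≤x ∷ _) = stage (run [] refl) ↭-refl refl (1≤x ∷ sorted)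

room : ∀ {w ps t v} → Zigzag w ps t → w ↭ upTo v → 2 * suc (length ps) + 1 ≤ suc v → 2 ≤ t
room {ps = ps} {t} {v} z w↭ bound = +-cancelˡ-≤ (2 * m) 2 t (begin
  2 * m + 2   ≡⟨ +-comm (2 * m) 2 ⟩
  2 + 2 * m   ≡⟨ sym (*-suc 2 m) ⟩
  2 * suc m   ≤⟨ s≤s⁻¹ (subst (_≤ suc v) (+-comm (2 * suc m) 1) bound) ⟩
  v           ≡⟨ trans (sym (trans (↭-length w↭) (length-upTo v))) (Zigzag-length z) ⟩
  2 * m + t   ∎)
  where
  open ≤-Reasoning
  m = length ps

stage-peak : ∀ {w ps t v r} → Zigzag w ps t → w ↭ upTo v → Linked _<_ (v ∷ suc v ∷ r) → 2 ≤ t →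
             Stage (map suc ps ++ suc v ∷ r) (suc v)
stage-peak {[]} (run _ refl) _ _ ()
stage-peak {_ ∷ _} {ps} {suc (suc _)} {v} {r} z w↭ pending (s≤s (s≤s _))
  with Zigzag-insert (↭upTo⇒below w↭) z
... | _ , z′ , w′↭ = stage z′ (↭-trans w′↭ (↭upTo-∷ʳ w↭)) split (Linked.tail pending)
  where
  split : map suc (ps ∷ʳ v) ++ r ≡ map suc ps ++ suc v ∷ r
  split = trans (cong (_++ r) (map-++ suc ps [ v ])) (∷ʳ-++ (map suc ps) (suc v) r)

stage-suc : ∀ {is v} → Spaced is → Stage is v → Stage is (suc v)
stage-suc _ (stage {rest = []} z w↭ split _) =
  stage (Zigzag-∷ʳ (↭upTo⇒below w↭) z) (↭upTo-∷ʳ w↭) split [-]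
stage-suc {v = v} spaced (stage {ps = ps} {rest = x ∷ r} z w↭ refl pending) with x ≟ suc v
... | no x≢1+v = stage (Zigzag-∷ʳ (↭upTo⇒below w↭) z) (↭upTo-∷ʳ w↭) refl
                       (≤∧≢⇒< (Linked.head pending) (≢-sym x≢1+v) ∷ Linked.tail pending)
... | yes refl = stage-peak z w↭ pending (room z w↭ next-peak-spaced)
  where
  next-peak-spaced : 2 * suc (length ps) + 1 ≤ suc v
  next-peak-spaced = subst (λ m → 2 * suc m + 1 ≤ suc v) (length-map suc ps) (Spaced-middle (map suc ps) spaced)

stage-done : ∀ {n is} → All (_≤ n) is → Stage is n →
             ∃[ w ] ∃[ ps ] ∃[ t ] (Zigzag w ps t × w ↭ upTo n × map suc ps ≡ is)
stage-done _ (stage {rest = []} z w↭ split _) = _ , _ , _ , z , w↭ , trans (sym (++-identityʳ _)) split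
stage-done bounded (stage {ps = ps} {rest = x ∷ _} _ _ split pending) =
  contradiction (All.lookup bounded x∈is) (<⇒≱ (Linked.head pending))
  where
  x∈is = subst (x ∈_) split (∈-++⁺ʳ (map suc ps) (here refl))

zigzag-realising : ∀ {n is} → Linked _<_ is → All (λ x → 1 ≤ x × x ≤ n) is → Spaced is →
                   ∃[ w ] ∃[ ps ] ∃[ t ] (Zigzag w ps t × w ↭ upTo n × map suc ps ≡ is)
zigzag-realising {n} {is} sorted bounds spaced = stage-done (All.map proj₂ bounds) (stages n)
  where
  stages : ∀ v → Stage is v
  stages zero    = stage-zero sorted (All.map proj₁ bounds)
  stages (suc v) = stage-suc spaced (stages v)

↭upTo⇒word : ∀ {n w} → w ↭ upTo n → ∃[ σ ] word {n} σ ≡ w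
↭upTo⇒word {n} {w} w↭ =
  subst (λ m → ∃[ σ ] word {m} σ ≡ w) (trans (↭-length w↭) (length-upTo n)) (σ , word-σ)
  where
  π = onIndices (↭⇒↭ₛ w↭)
  σ : Permutation′ (length w)
  σ = π ∘ₚ cast-id (sym (↭-length w↭))
  σ-lookup : ∀ i → toℕ (σ ⟨$⟩ʳ i) ≡ lookup w i
  σ-lookup i = begin
    toℕ (σ ⟨$⟩ʳ i)              ≡⟨ toℕ-cast _ (π ⟨$⟩ʳ i) ⟩
    toℕ (π ⟨$⟩ʳ i)              ≡⟨ sym (lookup-upTo n (π ⟨$⟩ʳ i)) ⟩
    lookup (upTo n) (π ⟨$⟩ʳ i)  ≡⟨ sym (onIndices-lookup (setoid ℕ) (↭⇒↭ₛ w↭) i) ⟩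
    lookup w i                  ∎
    where open ≡-Reasoning
  word-σ : word σ ≡ w
  word-σ = trans (tabulate-cong σ-lookup) (tabulate-lookup w)

peakValue⇔ : ∀ {w ps} → (∀ {b} → Peak w b ⇔ b ∈ ps) → ∀ v → PeakValue w v ⇔ v ∈ map suc ps
peakValue⇔ peak⇔ v = mk⇔
  (λ { (b , b-peak , refl) → ∈-map⁺ suc (Equivalence.to peak⇔ b-peak) })
  (λ v∈ → let (b , b∈ps , v≡) = ∈-map⁻ suc v∈ in b , Equivalence.from peak⇔ b∈ps , v≡)

theorem2p1 : (n : ℕ) → 3 ≤ n → (is : List ℕ) → Linked _<_ is → All (λ x → 1 ≤ x × x ≤ n) is →
    (∃[ σ ] ((v : ℕ) → IsCircularPeak {n} σ v ⇔ v ∈ is))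
    ⇔ ((j : Fin (length is)) → 2 * suc (toℕ j) + 1 ≤ lookup is j)
theorem2p1 n _ is sorted bounds = mk⇔ necessary sufficient
  where
  necessary : ∃[ σ ] (∀ v → IsCircularPeak σ v ⇔ v ∈ is) → Spaced is
  necessary (σ , cp⇔) = peaks-spaced (word-unique σ) sorted
    (λ {v} v∈is → Equivalence.to (circularPeak⇔peakValue σ v) (Equivalence.from (cp⇔ v) v∈is))
  sufficient : Spaced is → ∃[ σ ] (∀ v → IsCircularPeak σ v ⇔ v ∈ is)
  sufficient spaced with zigzag-realising sorted bounds spaced
  ... | w , ps , t , z , w↭ , refl with ↭upTo⇒word w↭
  ... | σ , refl = σ , λ v → ⇔-trans (circularPeak⇔peakValue σ v) (peakValue⇔ (Zigzag-peak⇔ z) v)
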